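{- Let $\mathcal{A}$ be a non-empty algebra in $\mathcal{C}$. Then $\mathcal{A}$ satisfies $(\star)$ iff, for all $\theta\in{\rm Con}(\mathcal{A})$, $\mathcal{A}/\theta$ satisfies $(\star)$.
   Context: $\mathcal{C}$ is an equational class of congruence-distributive algebras of some signature, such that every non-empty algebra $\mathcal{A}$ in $\mathcal{C}$ satisfies (H): $\nabla_{\mathcal{A}}=A^2$ is compact in the congruence lattice ${\rm Con}(\mathcal{A})$. $\mathcal{K}(\mathcal{A})$ is the set of finitely generated congruences; $\mathcal{B}(L)$ is the Boolean center of a bounded distributive lattice $L$; ${\rm Rad}(\mathcal{A})$ is the intersection of all maximal congruences. An algebra $\mathcal{A}$ satisfies $(\star)$ iff for every $\theta\in{\rm Con}(\mathcal{A})$ there exist $\alpha\in\mathcal{K}(\mathcal{A})$ and $\beta\in\mathcal{B}({\rm Con}(\mathcal{A}))$ with $\alpha\subseteq{\rm Rad}(\mathcal{A})$ and $\theta=\alpha\vee\beta$. -}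

module Defs where

open import Level using (0ℓ)
open import Data.Nat using (ℕ)
open import Data.Fin using (Fin)
open import Data.Unit using (⊤)
open import Data.Empty using (⊥)
open import Data.Product using (Σ; _×_; _,_; ∃)
open import Data.Sum using (_⊎_)
open import Relation.Nullary using (¬_)
open import Relation.Binary using (Rel; IsEquivalence)
open import Relation.Binary.PropositionalEquality using (_≡_)
import Data.Product

-- Signatures (finitary) and algebras.
-- Algebras are setoid-based: the carrier comes with an equality _≈_
-- (the identity congruence Δ), and the operations respect it.

record Signature : Set₁ where
  field
    Op    : Set
    arity : Op → ℕ

record Algebra (S : Signature) : Set₁ where
  open Signature S
  field
    Carrier       : Set
    _≈_           : Rel Carrier 0ℓ
    isEquivalence : IsEquivalence _≈_
    ⟦_⟧           : (f : Op) → (Fin (arity f) → Carrier) → Carrier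
    ⟦⟧-cong       : ∀ f {xs ys : Fin (arity f) → Carrier} →
                    (∀ i → xs i ≈ ys i) → ⟦ f ⟧ xs ≈ ⟦ f ⟧ ys

module _ (S : Signature) where
  open Signature S

  data Term : Set where
    var : ℕ → Term
    app : (f : Op) → (Fin (arity f) → Term) → Term

  Identity : Set
  Identity = Term × Term

module _ {S : Signature} (A : Algebra S) where
  open Algebra A

  eval : (ℕ → Carrier) → Term S → Carrier
  eval ρ (var n)    = ρ n
  eval ρ (app f ts) = ⟦ f ⟧ (λ i → eval ρ (ts i))

  Satisfies : Identity S → Set
  Satisfies (s , t) = ∀ (ρ : ℕ → Carrier) → eval ρ s ≈ eval ρ t

InClass : {S : Signature} {I : Set} → (I → Identity S) → Algebra S → Set
InClass E A = ∀ i → Satisfies A (E i)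

module _ {S : Signature} (A : Algebra S) where
  open Signature S
  open Algebra A

  record Congruence : Set₁ where
    field
      rel        : Carrier → Carrier → Set
      isEquiv    : IsEquivalence rel
      ≈⇒rel      : ∀ {x y} → x ≈ y → rel x y
      compatible : ∀ f {xs ys : Fin (arity f) → Carrier} →
                   (∀ i → rel (xs i) (ys i)) → rel (⟦ f ⟧ xs) (⟦ f ⟧ ys)

  data Cg (R : Carrier → Carrier → Set) : Carrier → Carrier → Set where
    base   : ∀ {x y} → R x y → Cg R x y
    ≈-incl : ∀ {x y} → x ≈ y → Cg R x y
    symm   : ∀ {x y} → Cg R x y → Cg R y x
    trans  : ∀ {x y z} → Cg R x y → Cg R y z → Cg R x z
    compat : ∀ f {xs ys : Fin (arity f) → Carrier} →
             (∀ i → Cg R (xs i) (ys i)) → Cg R (⟦ f ⟧ xs) (⟦ f ⟧ ys)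

  CgCon : (Carrier → Carrier → Set) → Congruence
  CgCon R = record
    { rel        = Cg R
    ; isEquiv    = record { refl = ≈-incl (IsEquivalence.refl isEquivalence)
                          ; sym = symm ; trans = trans }
    ; ≈⇒rel      = ≈-incl
    ; compatible = compat
    }

  open Congruence

  _⊆_ : Congruence → Congruence → Set
  θ ⊆ ψ = ∀ {x y} → rel θ x y → rel ψ x y

  _≐_ : Congruence → Congruence → Set
  θ ≐ ψ = (θ ⊆ ψ) × (ψ ⊆ θ)

  ∇ : Congruence
  ∇ = record
    { rel = λ _ _ → ⊤
    ; isEquiv = record { refl = _ ; sym = λ _ → _ ; trans = λ _ _ → _ }
    ; ≈⇒rel = λ _ → _
    ; compatible = λ _ _ → _ }

  Δ : Congruence
  Δ = record
    { rel = _≈_ ; isEquiv = isEquivalence ; ≈⇒rel = λ p → p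
    ; compatible = ⟦⟧-cong }

  _∧_ : Congruence → Congruence → Congruence
  θ ∧ ψ = record
    { rel = λ x y → rel θ x y × rel ψ x y
    ; isEquiv = record
      { refl  = IsEquivalence.refl (isEquiv θ) , IsEquivalence.refl (isEquiv ψ)
      ; sym   = λ { (p , q) → IsEquivalence.sym (isEquiv θ) p
                            , IsEquivalence.sym (isEquiv ψ) q }
      ; trans = λ { (p , q) (p' , q') → IsEquivalence.trans (isEquiv θ) p p'
                                      , IsEquivalence.trans (isEquiv ψ) q q' } }
    ; ≈⇒rel = λ p → ≈⇒rel θ p , ≈⇒rel ψ p
    ; compatible = λ f h → compatible θ f (λ i → Data.Product.proj₁ (h i))
                         , compatible ψ f (λ i → Data.Product.proj₂ (h i)) }

  _∨_ : Congruence → Congruence → Congruence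
  θ ∨ ψ = CgCon (λ x y → rel θ x y ⊎ rel ψ x y)

  ⋁ : {I : Set} → (I → Congruence) → Congruence
  ⋁ {I} θs = CgCon (λ x y → Σ I (λ i → rel (θs i) x y))

  Compact : Congruence → Set₁
  Compact θ = ∀ (I : Set) (θs : I → Congruence) → θ ⊆ ⋁ θs →
              Σ ℕ λ n → Σ (Fin n → I) λ js → θ ⊆ ⋁ (λ k → θs (js k))

  FinitelyGenerated : Congruence → Set
  FinitelyGenerated θ =
    Σ ℕ λ n → Σ (Fin n → Carrier × Carrier) λ ps →
      θ ≐ CgCon (λ x y → Σ (Fin n) λ k → ps k ≡ (x , y))

  Boolean : Congruence → Set₁
  Boolean θ = Σ Congruence λ ψ → ((θ ∧ ψ) ≐ Δ) × ((θ ∨ ψ) ≐ ∇)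

  Proper : Congruence → Set
  Proper θ = ¬ (∇ ⊆ θ)

  Maximal : Congruence → Set₁
  Maximal θ = Proper θ × (∀ ψ → θ ⊆ ψ → Proper ψ → ψ ≐ θ)

  -- α ⊆ Rad(A), where Rad(A) is the intersection of all maximal congruences
  BelowRad : Congruence → Set₁
  BelowRad α = ∀ (μ : Congruence) → Maximal μ → α ⊆ μ

  CongDistributive : Set₁
  CongDistributive = ∀ θ ψ χ → (θ ∧ (ψ ∨ χ)) ≐ ((θ ∧ ψ) ∨ (θ ∧ χ))

  Star : Set₁
  Star = ∀ (θ : Congruence) →
    Σ Congruence λ α → Σ Congruence λ β →
      FinitelyGenerated α × Boolean β × BelowRad α × (θ ≐ (α ∨ β))

-- Quotient algebra A/θ (setoid style: same carrier, equality θ).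

_/_ : {S : Signature} (A : Algebra S) → Congruence A → Algebra S
A / θ = record
  { Carrier       = Algebra.Carrier A
  ; _≈_           = Congruence.rel θ
  ; isEquivalence = Congruence.isEquiv θ
  ; ⟦_⟧           = Algebra.⟦_⟧ A
  ; ⟦⟧-cong       = Congruence.compatible θ
  }

module Submission where

-- The backward direction is immediate: A/Δ is (definitionally)
-- A itself.  For the forward direction fix θ ∈ Con(A).  A congruence ψ of A/θ
-- is a congruence of A containing θ ("lift ψ"); conversely every congruence
-- χ of A has an image "push χ = Cg_{A/θ}(χ)" in A/θ, i.e. (χ ∨ θ)/θ.  Applying
-- (⋆) in A to lift ψ gives lift ψ = α ∨ β, and we show that pushing preserves
-- everything in sight:
--   * push is monotone and preserves joins, and ψ = push (lift ψ);
--   * push of a finitely generated congruence is finitely generated;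
--   * maximal congruences of A/θ lift to maximal congruences of A, so push
--     preserves lying below the radical;
--   * in a congruence-distributive algebra push preserves complementedness.
-- Hence ψ = push α ∨ push β witnesses (⋆) in A/θ.

open import Defs
open import Function.Bundles using (_⇔_; mk⇔)
open import Data.Product using (_,_; proj₁; proj₂)
open import Data.Sum using (inj₁; inj₂)
open import Relation.Binary using (IsEquivalence)

open Congruence

module Lattice {S : Signature} (A : Algebra S) where
  open Algebra A using (Carrier)

  Cg-least : (R : Carrier → Carrier → Set) (χ : Congruence A) →
             (∀ {x y} → R x y → rel χ x y) → _⊆_ A (CgCon A R) χ
  Cg-least R χ h (base p)      = h p
  Cg-least R χ h (≈-incl p)    = ≈⇒rel χ p
  Cg-least R χ h (symm p)      = IsEquivalence.sym (isEquiv χ) (Cg-least R χ h p)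
  Cg-least R χ h (trans p q)   =
    IsEquivalence.trans (isEquiv χ) (Cg-least R χ h p) (Cg-least R χ h q)
  Cg-least R χ h (compat f ps) = compatible χ f (λ i → Cg-least R χ h (ps i))

  ∨-least : (χ χ' ω : Congruence A) →
            _⊆_ A χ ω → _⊆_ A χ' ω → _⊆_ A (_∨_ A χ χ') ω
  ∨-least χ χ' ω χ⊆ω χ'⊆ω = Cg-least _ ω (λ { (inj₁ p) → χ⊆ω p ; (inj₂ p) → χ'⊆ω p })

  ≐-trans : {χ χ' χ'' : Congruence A} →
            _≐_ A χ χ' → _≐_ A χ' χ'' → _≐_ A χ χ''
  ≐-trans (p , p') (q , q') = (λ r → q (p r)) , (λ r → p' (q' r))

  -- In a distributive Con(A), disjoint β and γ stay disjoint modulo θ: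
  -- (β ∨ θ) ∧ (γ ∨ θ) = ((β ∨ θ) ∧ γ) ∨ ((β ∨ θ) ∧ θ) ≤ ((γ ∧ β) ∨ (γ ∧ θ)) ∨ θ ≤ θ.
  disjoint-modulo : CongDistributive A → (β γ θ : Congruence A) →
                    _⊆_ A (_∧_ A β γ) (Δ A) →
                    _⊆_ A (_∧_ A (_∨_ A β θ) (_∨_ A γ θ)) θ
  disjoint-modulo dist β γ θ β∧γ⊆Δ p =
    ∨-least (_∧_ A (_∨_ A β θ) γ) (_∧_ A (_∨_ A β θ) θ) θ γ-part proj₂
      (proj₁ (dist (_∨_ A β θ) γ θ) p)
    where
    γ-part : _⊆_ A (_∧_ A (_∨_ A β θ) γ) θ
    γ-part (b , g) =
      ∨-least (_∧_ A γ β) (_∧_ A γ θ) θ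
        (λ { (g' , b') → ≈⇒rel θ (β∧γ⊆Δ (b' , g')) }) proj₂
        (proj₁ (dist γ β θ) (g , b))

module Quotient {S : Signature} (A : Algebra S) (θ : Congruence A) where
  open Lattice using (Cg-least; ∨-least; disjoint-modulo)

  lift : Congruence (A / θ) → Congruence A
  lift ψ = record { rel = rel ψ ; isEquiv = isEquiv ψ
                  ; ≈⇒rel = λ p → ≈⇒rel ψ (≈⇒rel θ p) ; compatible = compatible ψ }

  lower : (χ : Congruence A) → _⊆_ A θ χ → Congruence (A / θ)
  lower χ θ⊆χ = record { rel = rel χ ; isEquiv = isEquiv χ
                       ; ≈⇒rel = θ⊆χ ; compatible = compatible χ }

  -- The image (χ ∨ θ)/θ of a congruence χ of A in A/θ.
  push : Congruence A → Congruence (A / θ)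
  push χ = CgCon (A / θ) (rel χ)

  Cg-in-quotient : (R : Algebra.Carrier A → Algebra.Carrier A → Set) →
                   _⊆_ A (CgCon A R) (lift (CgCon (A / θ) R))
  Cg-in-quotient R = Cg-least A R (lift (CgCon (A / θ) R)) base

  push-below : (χ : Congruence A) → _⊆_ A (lift (push χ)) (_∨_ A χ θ)
  push-below χ =
    Cg-least (A / θ) (rel χ) (lower (_∨_ A χ θ) (λ p → base (inj₂ p)))
      (λ p → base (inj₁ p))

  push-mono : (χ χ' : Congruence A) → _⊆_ A χ χ' → _⊆_ (A / θ) (push χ) (push χ')
  push-mono χ χ' χ⊆χ' = Cg-least (A / θ) (rel χ) (push χ') (λ p → base (χ⊆χ' p))

  push-join : (χ χ' : Congruence A) →
              _≐_ (A / θ) (push (_∨_ A χ χ')) (_∨_ (A / θ) (push χ) (push χ'))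
  push-join χ χ' =
    Cg-least (A / θ) (rel (_∨_ A χ χ')) pushes
      (Cg-least A _ (lift pushes)
        (λ { (inj₁ p) → base (inj₁ (base p)) ; (inj₂ p) → base (inj₂ (base p)) }))
    , ∨-least (A / θ) (push χ) (push χ') (push (_∨_ A χ χ'))
        (push-mono χ (_∨_ A χ χ') (λ p → base (inj₁ p)))
        (push-mono χ' (_∨_ A χ χ') (λ p → base (inj₂ p)))
    where
    pushes = _∨_ (A / θ) (push χ) (push χ')

  push-of-lift : (ψ : Congruence (A / θ)) (χ : Congruence A) →
                 _≐_ A (lift ψ) χ → _≐_ (A / θ) ψ (push χ)
  push-of-lift ψ χ (ψ⊆χ , χ⊆ψ) = (λ p → base (ψ⊆χ p)) , Cg-least (A / θ) (rel χ) ψ χ⊆ψ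

  -- If α = Cg(P) with P finite, then push α = Cg_{A/θ}(P).
  push-finitelyGenerated : (α : Congruence A) → FinitelyGenerated A α →
                           FinitelyGenerated (A / θ) (push α)
  push-finitelyGenerated α (n , ps , α⊆P , P⊆α) =
    n , ps
    , Cg-least (A / θ) (rel α) (CgCon (A / θ) _) (λ p → Cg-in-quotient _ (α⊆P p))
    , Cg-least (A / θ) _ (push α) (λ p → base (P⊆α (base p)))

  -- Con(A/θ) is the interval [θ, ∇] of Con(A), so maximality transfers.
  lift-maximal : (μ : Congruence (A / θ)) → Maximal (A / θ) μ → Maximal A (lift μ)
  lift-maximal μ (proper , maximal) =
    proper , λ χ μ⊆χ properχ → maximal (lower χ (λ p → μ⊆χ (≈⇒rel μ p))) μ⊆χ properχ

  push-belowRad : (α : Congruence A) → BelowRad A α → BelowRad (A / θ) (push α)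
  push-belowRad α α⊆Rad μ maxμ =
    Cg-least (A / θ) (rel α) μ (α⊆Rad (lift μ) (lift-maximal μ maxμ))

  push-boolean : CongDistributive A → (β : Congruence A) →
                 Boolean A β → Boolean (A / θ) (push β)
  push-boolean dist β (γ , (β∧γ⊆Δ , _) , (_ , ∇⊆β∨γ)) =
    push γ , (disjoint , (λ p → ≈-incl p , ≈-incl p)) , ((λ _ → _) , covering)
    where
    disjoint : _⊆_ (A / θ) (_∧_ (A / θ) (push β) (push γ)) (Δ (A / θ))
    disjoint (p , q) = disjoint-modulo A dist β γ θ β∧γ⊆Δ (push-below β p , push-below γ q)

    covering : _⊆_ (A / θ) (∇ (A / θ)) (_∨_ (A / θ) (push β) (push γ))
    covering {x} {y} t = proj₁ (push-join β γ) (base (∇⊆β∨γ {x} {y} t))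

star-quotient : {S : Signature} (A : Algebra S) → CongDistributive A →
                Star A → (θ : Congruence A) → Star (A / θ)
star-quotient A dist star θ ψ =
  let open Quotient A θ
      (α , β , fgα , boolβ , α⊆Rad , ψ≐α∨β) = star (lift ψ)
  in push α , push β
     , push-finitelyGenerated α fgα
     , push-boolean dist β boolβ
     , push-belowRad α α⊆Rad
     , Lattice.≐-trans (A / θ) {ψ} {push (_∨_ A α β)} {_∨_ (A / θ) (push α) (push β)}
         (push-of-lift ψ (_∨_ A α β) ψ≐α∨β) (push-join α β)

proposition4p45 : (S : Signature) (I : Set) (E : I → Identity S) →
    (∀ (B : Algebra S) → InClass E B → CongDistributive B) →
    (∀ (B : Algebra S) → InClass E B → Algebra.Carrier B → Compact B (∇ B)) →
    (A : Algebra S) → InClass E A → Algebra.Carrier A →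
    Star A ⇔ (∀ (θ : Congruence A) → Star (A / θ))
proposition4p45 _ _ _ distributive _ A A∈C _ =
  -- the backward direction uses that A / Δ A is A itself
  mk⇔ (star-quotient A (distributive A A∈C)) (λ starQuotients → starQuotients (Δ A))
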